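{- For $0\le k\le n$, \[D(n,k)=\tfrac12B(n,k)+\tfrac12\binom{n}{k}(-1)^k,\qquad \widetilde{D}(n,k)=\tfrac12B(n,k)-\tfrac12\binom{n}{k}(-1)^k.\]
   Context: $\mathcal{B}_n$ is the group of permutations $\sigma$ of $\{ -n,\dots,n\}$ with $\sigma(-k)=-\sigma(k)$ for all $k$. For $\sigma\in\mathcal{B}_n$, $\mathrm{desc}(\sigma)$ is the number of $i\in\{0,\dots,n-1\}$ with $\sigma(i)>\sigma(i+1)$ (descends of $(0,\sigma(1),\dots,\sigma(n))$). $B(n,k)=\#\{\sigma\in\mathcal{B}_n:\mathrm{desc}(\sigma)=k\}$. $\mathcal{D}_n$ is the set of $\sigma\in\mathcal{B}_n$ such that $\{\sigma(1),\dots,\sigma(n)\}$ contains an even number of negative elements, and $\widetilde{\mathcal{D}}_n=\mathcal{B}_n\setminus\mathcal{D}_n$. $D(n,k)=\#\{\sigma\in\mathcal{D}_n:\mathrm{desc}(\sigma)=k\}$ and $\widetilde{D}(n,k)=\#\{\sigma\in\widetilde{\mathcal{D}}_n:\mathrm{desc}(\sigma)=k\}$. -}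

module Defs where

open import Data.Nat using (ℕ; zero; suc; _+_)
open import Data.Integer using (ℤ; +_; -[1+_]; ∣_∣; _<?_; 0ℤ)
import Data.Integer.Properties as ℤP
open import Data.List using (List; []; _∷_; map; _++_; concatMap; filter; length; upTo)
open import Data.List.Relation.Unary.Unique.Propositional using (Unique)
import Data.Nat as ℕ
open import Data.List.Relation.Unary.Unique.DecPropositional ℕ._≟_ using (unique?)
open import Relation.Nullary using (does)
open import Data.Bool using (Bool; true; false; if_then_else_)
import Data.Bool

signedVals : ℕ → List ℤ
signedVals n = map (λ i → + suc i) (upTo n) ++ map (λ i → -[1+ i ]) (upTo n)

words : ℕ → ℕ → List (List ℤ)
words n zero    = [] ∷ []
words n (suc m) = concatMap (λ w → map (_∷ w) (signedVals n)) (words n m)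

-- A signed permutation σ ∈ 𝓑ₙ is determined by its window (σ(1),…,σ(n));
-- a word of length n with letters in ±{1..n} is such a window iff
-- the absolute values |σ(1)|,…,|σ(n)| are pairwise distinct.
Bn : ℕ → List (List ℤ)
Bn n = filter (λ w → unique? (map ∣_∣ w)) (words n n)

descents : List ℤ → ℕ
descents []           = 0
descents (x ∷ [])     = 0
descents (x ∷ y ∷ ys) = (if does (y <? x) then 1 else 0) + descents (y ∷ ys)

desc : List ℤ → ℕ
desc w = descents (0ℤ ∷ w)

negs : List ℤ → ℕ
negs w = length (filter (λ x → x <? 0ℤ) w)

even? : ℕ → Bool
even? zero          = true
even? (suc zero)    = false
even? (suc (suc m)) = even? m

Dn : ℕ → List (List ℤ)
Dn n = filter (λ w → Data.Bool._≟_ (even? (negs w)) true) (Bn n)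

Dtn : ℕ → List (List ℤ)
Dtn n = filter (λ w → Data.Bool._≟_ (even? (negs w)) false) (Bn n)

withDesc : ℕ → List (List ℤ) → ℕ
withDesc k ws = length (filter (λ w → desc w ℕ.≟ k) ws)

B : ℕ → ℕ → ℕ
B n k = withDesc k (Bn n)

D : ℕ → ℕ → ℕ
D n k = withDesc k (Dn n)

Dt : ℕ → ℕ → ℕ
Dt n k = withDesc k (Dtn n)

module Submission where

-- Write sign(w) = (-1)^(number of negative letters of w).  As 𝓑ₙ = 𝓓ₙ ⊎ 𝓓̃ₙ,
-- B = D + D̃ and D - D̃ = Σ_{σ ∈ 𝓑ₙ, desc σ = k} sign σ, so the corollary reduces
-- to the signed count  Σ_{σ ∈ 𝓑ₙ, desc σ = k} sign σ = C(n,k)·(-1)^k  (module ByParity).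
-- This is generalised (module SignedCount) to words w of length m with distinct
-- absolute values from a set S of available values, |S| = m, whose descents are
-- counted in (a, w₁, …, w_m) on top of b descents already recorded:
--   (1) if |a| < min S the signed sum is C(m,k-b)·(-1)^(k-b)  (shifted m b k);
--   (2) if some s ∈ S has s < |a| the signed sum is 0.
-- Both follow by induction on m, grouping words by their first letter ±v: for v
-- not minimal in S, a smaller value stays available and (2) kills both terms; for
-- v = min S, +v is an ascent and -v a descent after a, and the two instances of
-- (1) combine by Pascal's rule.

open import Defs
open import Data.Nat using (ℕ; _≤_)
open import Data.Nat.Combinatorics using (_C_)
open import Data.Integer using (ℤ; +_; _+_; _-_; _*_; -1ℤ; _^_)
open import Data.Product using (_×_)
open import Relation.Binary.PropositionalEquality using (_≡_)

open import Data.Nat as ℕ using (zero; suc; _<_; z≤n; s≤s) renaming (_+_ to _+ℕ_)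
import Data.Nat.Properties as ℕP
open import Data.Nat.Combinatorics using (nCk+nC[k+1]≡[n+1]C[k+1])
open import Data.Integer as ℤ using (-[1+_]; ∣_∣; 0ℤ; 1ℤ; -_; _<?_)
import Data.Integer.Properties as ℤP
open import Data.Integer.Tactic.RingSolver using (solve-∀)
open import Data.List using (List; []; _∷_; map; _++_; concatMap; filter; length; upTo)
import Data.List.Properties as ListP
open import Data.List.Relation.Unary.All using (all?)
open import Data.List.Relation.Unary.Unique.DecPropositional ℕ._≟_ using (unique?)
open import Data.Bool using (Bool; true; false; if_then_else_; _∧_; _∨_; not)
import Data.Bool.Properties as BoolP
import Data.Bool as Bool
open import Algebra.Bundles using (CommutativeMonoid)
open import Algebra.Properties.CommutativeSemigroup (CommutativeMonoid.commutativeSemigroup BoolP.∧-commutativeMonoid)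
  using () renaming (interchange to ∧-interchange)
open import Relation.Nullary using (Dec; does; yes; no; ¬_; ¬?)
open import Relation.Nullary.Decidable using (dec-true; dec-false)
open import Relation.Binary.PropositionalEquality using (refl; sym; trans; cong; cong₂; subst; module ≡-Reasoning)
open import Data.Product using (_,_; proj₁; proj₂; ∃₂)

sumBy : {A : Set} → (A → ℤ) → List A → ℤ
sumBy f []       = 0ℤ
sumBy f (x ∷ xs) = f x + sumBy f xs

sumBy-cong : {A : Set} {f g : A → ℤ} (xs : List A) → (∀ x → f x ≡ g x) → sumBy f xs ≡ sumBy g xs
sumBy-cong []       f≗g = refl
sumBy-cong (x ∷ xs) f≗g = cong₂ _+_ (f≗g x) (sumBy-cong xs f≗g)

sumBy-zero : {A : Set} (xs : List A) → sumBy (λ _ → 0ℤ) xs ≡ 0ℤ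
sumBy-zero []       = refl
sumBy-zero (x ∷ xs) = trans (ℤP.+-identityˡ _) (sumBy-zero xs)

sumBy-++ : {A : Set} (f : A → ℤ) (xs ys : List A) → sumBy f (xs ++ ys) ≡ sumBy f xs + sumBy f ys
sumBy-++ f []       ys = sym (ℤP.+-identityˡ _)
sumBy-++ f (x ∷ xs) ys = trans (cong (_+_ (f x)) (sumBy-++ f xs ys)) (sym (ℤP.+-assoc (f x) _ _))

sumBy-map : {A B : Set} (f : B → ℤ) (g : A → B) (xs : List A) → sumBy f (map g xs) ≡ sumBy (λ x → f (g x)) xs
sumBy-map f g []       = refl
sumBy-map f g (x ∷ xs) = cong (_+_ (f (g x))) (sumBy-map f g xs)

sumBy-concatMap : {A B : Set} (f : B → ℤ) (g : A → List B) (xs : List A) →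
  sumBy f (concatMap g xs) ≡ sumBy (λ x → sumBy f (g x)) xs
sumBy-concatMap f g []       = refl
sumBy-concatMap f g (x ∷ xs) =
  trans (sumBy-++ f (g x) (concatMap g xs)) (cong (_+_ (sumBy f (g x))) (sumBy-concatMap f g xs))

sumBy-+ : {A : Set} (f g : A → ℤ) (xs : List A) → sumBy (λ x → f x + g x) xs ≡ sumBy f xs + sumBy g xs
sumBy-+ f g []       = refl
sumBy-+ f g (x ∷ xs) = trans (cong (_+_ (f x + g x)) (sumBy-+ f g xs)) (interchange (f x) (g x) (sumBy f xs) (sumBy g xs))
  where
  interchange : ∀ a b c d → (a + b) + (c + d) ≡ (a + c) + (b + d)
  interchange = solve-∀

sumBy-neg : {A : Set} (f : A → ℤ) (xs : List A) → sumBy (λ x → - f x) xs ≡ - sumBy f xs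
sumBy-neg f []       = refl
sumBy-neg f (x ∷ xs) = trans (cong (_+_ (- f x)) (sumBy-neg f xs)) (sym (ℤP.neg-distrib-+ (f x) (sumBy f xs)))

sumBy-swap : {A B : Set} (h : A → B → ℤ) (xs : List A) (ys : List B) →
  sumBy (λ y → sumBy (λ x → h x y) xs) ys ≡ sumBy (λ x → sumBy (λ y → h x y) ys) xs
sumBy-swap h xs []       = sym (sumBy-zero xs)
sumBy-swap h xs (y ∷ ys) = trans (cong (_+_ (sumBy (λ x → h x y) xs)) (sumBy-swap h xs ys))
  (sym (sumBy-+ (λ x → h x y) (λ x → sumBy (λ y → h x y) ys) xs))

when : Bool → ℤ → ℤ
when true  z = z
when false z = 0ℤ

sumBy-filter : {A : Set} {P : A → Set} (P? : ∀ x → Dec (P x)) (f : A → ℤ) (xs : List A) →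
  sumBy f (filter P? xs) ≡ sumBy (λ x → when (does (P? x)) (f x)) xs
sumBy-filter P? f []       = refl
sumBy-filter P? f (x ∷ xs) with does (P? x)
... | true  = cong (_+_ (f x)) (sumBy-filter P? f xs)
... | false = trans (sumBy-filter P? f xs) (sym (ℤP.+-identityˡ _))

length-as-sum : {A : Set} (xs : List A) → + length xs ≡ sumBy (λ _ → 1ℤ) xs
length-as-sum []       = refl
length-as-sum (x ∷ xs) = cong (_+_ (1ℤ)) (length-as-sum xs)

count-as-sum : {A : Set} {P : A → Set} (P? : ∀ x → Dec (P x)) (xs : List A) →
  + length (filter P? xs) ≡ sumBy (λ x → when (does (P? x)) 1ℤ) xs
count-as-sum P? xs = trans (length-as-sum (filter P? xs)) (sumBy-filter P? (λ _ → 1ℤ) xs)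

sumBelow : ℕ → (ℕ → ℤ) → ℤ
sumBelow zero    h = 0ℤ
sumBelow (suc n) h = sumBelow n h + h n

sumBy-upTo : (h : ℕ → ℤ) (n : ℕ) → sumBy h (upTo n) ≡ sumBelow n h
sumBy-upTo h zero    = refl
sumBy-upTo h (suc n) = begin
    sumBy h (upTo (suc n))        ≡⟨ cong (sumBy h) (sym (ListP.upTo-∷ʳ n)) ⟩
    sumBy h (upTo n ++ (n ∷ []))  ≡⟨ sumBy-++ h (upTo n) (n ∷ []) ⟩
    sumBy h (upTo n) + (h n + 0ℤ) ≡⟨ cong₂ _+_ (sumBy-upTo h n) (ℤP.+-identityʳ (h n)) ⟩
    sumBelow n h + h n            ∎
  where open ≡-Reasoning

sumBelow-cong : ∀ n {h g : ℕ → ℤ} → (∀ i → i < n → h i ≡ g i) → sumBelow n h ≡ sumBelow n g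
sumBelow-cong zero    h≗g = refl
sumBelow-cong (suc n) h≗g = cong₂ _+_ (sumBelow-cong n (λ i i<n → h≗g i (ℕP.m<n⇒m<1+n i<n))) (h≗g n ℕP.≤-refl)

when-zero : ∀ p → when p 0ℤ ≡ 0ℤ
when-zero true  = refl
when-zero false = refl

when-+ : ∀ p x y → when p x + when p y ≡ when p (x + y)
when-+ true  x y = refl
when-+ false x y = refl

when-∧ : ∀ p q x → when (p ∧ q) x ≡ when p (when q x)
when-∧ true  q x = refl
when-∧ false q x = refl

when-cong : ∀ p {x y} → (p ≡ true → x ≡ y) → when p x ≡ when p y
when-cong true  x≡y = x≡y refl
when-cong false x≡y = refl

sumBy-when : {A : Set} (p : Bool) (f : A → ℤ) (xs : List A) → sumBy (λ x → when p (f x)) xs ≡ when p (sumBy f xs)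
sumBy-when true  f xs = refl
sumBy-when false f xs = sumBy-zero xs

negateWhen : Bool → ℤ → ℤ
negateWhen true  z = - z
negateWhen false z = z

when-negateWhen : ∀ p s x → when p (negateWhen s x) ≡ negateWhen s (when p x)
when-negateWhen true  s     x = refl
when-negateWhen false true  x = refl
when-negateWhen false false x = refl

sumBy-negateWhen : {A : Set} (s : Bool) (f : A → ℤ) (xs : List A) →
  sumBy (λ x → negateWhen s (f x)) xs ≡ negateWhen s (sumBy f xs)
sumBy-negateWhen true  f xs = sumBy-neg f xs
sumBy-negateWhen false f xs = refl

sign : List ℤ → ℤ
sign []      = 1ℤ
sign (x ∷ w) = negateWhen (does (x <? 0ℤ)) (sign w)

-- Sets of available absolute values are Boolean predicates on ℕ;
-- remove P v deletes v from P.
remove : (ℕ → Bool) → ℕ → ℕ → Bool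
remove P v u = P u ∧ not (does (v ℕ.≟ u))

admissible : (ℕ → Bool) → List ℕ → Bool
admissible P []       = true
admissible P (v ∷ vs) = P v ∧ admissible (remove P v) vs

isDescent : ℤ → ℤ → ℕ
isDescent a x = if does (x <? a) then 1 else 0

weight : ℤ → (ℕ → Bool) → ℕ → ℕ → List ℤ → ℤ
weight a P b k w = when (admissible P (map ∣_∣ w)) (when (does (b +ℕ descents (a ∷ w) ℕ.≟ k)) (sign w))

weight-∷ : ∀ a P b k x w →
  weight a P b k (x ∷ w) ≡
  when (P ∣ x ∣) (negateWhen (does (x <? 0ℤ)) (weight x (remove P ∣ x ∣) (b +ℕ isDescent a x) k w))
weight-∷ a P b k x w = begin
    when (P ∣ x ∣ ∧ ok) (when (does (b +ℕ (t +ℕ d) ℕ.≟ k)) (negateWhen s (sign w)))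
      ≡⟨ when-∧ (P ∣ x ∣) ok _ ⟩
    when (P ∣ x ∣) (when ok (when (does (b +ℕ (t +ℕ d) ℕ.≟ k)) (negateWhen s (sign w))))
      ≡⟨ cong (λ j → when (P ∣ x ∣) (when ok (when (does (j ℕ.≟ k)) (negateWhen s (sign w))))) (sym (ℕP.+-assoc b t d)) ⟩
    when (P ∣ x ∣) (when ok (when (does (b +ℕ t +ℕ d ℕ.≟ k)) (negateWhen s (sign w))))
      ≡⟨ cong (λ z → when (P ∣ x ∣) (when ok z)) (when-negateWhen _ s (sign w)) ⟩
    when (P ∣ x ∣) (when ok (negateWhen s (when (does (b +ℕ t +ℕ d ℕ.≟ k)) (sign w))))
      ≡⟨ cong (when (P ∣ x ∣)) (when-negateWhen ok s _) ⟩
    when (P ∣ x ∣) (negateWhen s (weight x (remove P ∣ x ∣) (b +ℕ t) k w)) ∎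
  where
  open ≡-Reasoning
  ok = admissible (remove P ∣ x ∣) (map ∣_∣ w)
  s  = does (x <? 0ℤ)
  t  = isDescent a x
  d  = descents (x ∷ w)

signedBinomial : ℕ → ℕ → ℤ
signedBinomial m k = + (m C k) * (-1ℤ ^ k)

-- shifted m b k = signedBinomial m (k - b) if b ≤ k, and 0 otherwise:
-- the count once b descents have already been recorded.
shifted : ℕ → ℕ → ℕ → ℤ
shifted m zero    k       = signedBinomial m k
shifted m (suc b) zero    = 0ℤ
shifted m (suc b) (suc k) = shifted m b k

shifted-pascal : ∀ m b k → shifted m b k - shifted m (suc b) k ≡ shifted (suc m) b k
shifted-pascal m zero    zero    = refl
shifted-pascal m zero    (suc k) = begin
    + (m C suc k) * (-1ℤ * s) - + (m C k) * s   ≡⟨ regroup s (+ (m C k)) (+ (m C suc k)) ⟩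
    (+ (m C k) + + (m C suc k)) * (-1ℤ * s)     ≡⟨ cong (_* (-1ℤ * s)) (sym (ℤP.pos-+ (m C k) (m C suc k))) ⟩
    + (m C k +ℕ m C suc k) * (-1ℤ * s)          ≡⟨ cong (λ c → + c * (-1ℤ * s)) (nCk+nC[k+1]≡[n+1]C[k+1] m k) ⟩
    + (suc m C suc k) * (-1ℤ * s)               ∎
  where
  open ≡-Reasoning
  s = -1ℤ ^ k
  regroup : ∀ s x y → y * (-1ℤ * s) - x * s ≡ (x + y) * (-1ℤ * s)
  regroup = solve-∀
shifted-pascal m (suc b) zero    = refl
shifted-pascal m (suc b) (suc k) = shifted-pascal m b k

shifted-zero : ∀ b k → when (does (b ℕ.≟ k)) 1ℤ ≡ shifted 0 b k
shifted-zero zero    zero    = refl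
shifted-zero zero    (suc k) = sym (ℤP.*-zeroˡ (-1ℤ ^ suc k))
shifted-zero (suc b) zero    = refl
shifted-zero (suc b) (suc k) = shifted-zero b k

count : (ℕ → Bool) → ℕ → ℕ
count P zero    = 0
count P (suc j) = count P j +ℕ (if P (suc j) then 1 else 0)

anyUpTo : (ℕ → Bool) → ℕ → Bool
anyUpTo P zero    = false
anyUpTo P (suc i) = anyUpTo P i ∨ P (suc i)

isMinimal : (ℕ → Bool) → ℕ → Bool
isMinimal P i = P (suc i) ∧ not (anyUpTo P i)

remove-other : ∀ P v u → ¬ v ≡ u → remove P v u ≡ P u
remove-other P v u v≢u rewrite dec-false (v ℕ.≟ u) v≢u = BoolP.∧-identityʳ (P u)

remove-self : ∀ P v → remove P v v ≡ false
remove-self P v rewrite dec-true (v ℕ.≟ v) refl = BoolP.∧-zeroʳ (P v)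

remove-true : ∀ P v u → remove P v u ≡ true → P u ≡ true × ¬ v ≡ u
remove-true P v u removed with v ℕ.≟ u
... | no v≢u = trans (sym (remove-other P v u v≢u)) removed , v≢u
... | yes refl with () ← trans (sym (remove-self P v)) removed

count-remove-above : ∀ P i n → n ≤ i → count (remove P (suc i)) n ≡ count P n
count-remove-above P i zero    _   = refl
count-remove-above P i (suc n) n<i =
  cong₂ _+ℕ_ (count-remove-above P i n (ℕP.<⇒≤ n<i))
    (cong (λ p → if p then 1 else 0) (remove-other P (suc i) (suc n) (λ e → ℕP.<⇒≢ n<i (sym (ℕP.suc-injective e)))))

count-remove : ∀ P i n → i < n → P (suc i) ≡ true → suc (count (remove P (suc i)) n) ≡ count P n
count-remove P i (suc n) (s≤s i≤n) available with i ℕ.≟ n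
... | yes refl rewrite remove-self P (suc i) | available | count-remove-above P i i ℕP.≤-refl =
  trans (cong suc (ℕP.+-identityʳ _)) (ℕP.+-comm 1 _)
... | no i≢n rewrite remove-other P (suc i) (suc n) (λ e → i≢n (ℕP.suc-injective e)) =
  cong (_+ℕ (if P (suc n) then 1 else 0)) (count-remove P i n (ℕP.≤∧≢⇒< i≤n i≢n) available)

count-remove-suc : ∀ P i n m → i < n → P (suc i) ≡ true → count P n ≡ suc m → count (remove P (suc i)) n ≡ m
count-remove-suc P i n m i<n available sized = ℕP.suc-injective (trans (count-remove P i n i<n available) sized)

anyUpTo-false : ∀ P i → anyUpTo P i ≡ false → ∀ j → j < i → P (suc j) ≡ false
anyUpTo-false P (suc i) none j j<1+i with anyUpTo P i in noneBelow | P (suc i) in last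
... | false | false with j ℕ.≟ i
...   | yes refl = last
...   | no j≢i   = anyUpTo-false P i noneBelow j (ℕP.≤∧≢⇒< (ℕP.≤-pred j<1+i) j≢i)

anyUpTo-true : ∀ P i → anyUpTo P i ≡ true → ∃₂ λ j (_ : j < i) → P (suc j) ≡ true
anyUpTo-true P (suc i) some with anyUpTo P i in someBelow | P (suc i) in last
... | true  | _ with anyUpTo-true P i someBelow
...   | j , j<i , available = j , ℕP.m<n⇒m<1+n j<i , available
anyUpTo-true P (suc i) some | false | true = i , ℕP.≤-refl , last

anyUpTo-false-≤ : ∀ P i j → anyUpTo P i ≡ false → P (suc j) ≡ true → i ≤ j
anyUpTo-false-≤ P i j none availableJ = ℕP.≮⇒≥ j≮i
  where
  j≮i : ¬ j < i
  j≮i j<i with () ← trans (sym (anyUpTo-false P i none j j<i)) availableJ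

isMinimal-spec : ∀ P i → isMinimal P i ≡ true → P (suc i) ≡ true × anyUpTo P i ≡ false
isMinimal-spec P i minimal with P (suc i) | anyUpTo P i
... | true | false = refl , refl

count-none : ∀ P n → (∀ j → j < n → P (suc j) ≡ false) → count P n ≡ 0
count-none P zero    none = refl
count-none P (suc n) none rewrite none n ℕP.≤-refl =
  trans (ℕP.+-identityʳ _) (count-none P n (λ j j<n → none j (ℕP.m<n⇒m<1+n j<n)))

count-suc⇒anyUpTo : ∀ P n m → count P n ≡ suc m → anyUpTo P n ≡ true
count-suc⇒anyUpTo P n m sized with anyUpTo P n in any
... | true  = refl
... | false with () ← trans (sym (count-none P n (anyUpTo-false P n any))) sized

count-zero : ∀ P n → count P n ≡ 0 → ∀ j → j < n → P (suc j) ≡ false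
count-zero P (suc n) empty j j<1+n with P (suc n) in last | j ℕ.≟ n
... | false | yes refl = last
... | false | no j≢n   = count-zero P n (trans (sym (ℕP.+-identityʳ _)) empty) j (ℕP.≤∧≢⇒< (ℕP.≤-pred j<1+n) j≢n)
... | true  | _ with () ← trans (ℕP.+-comm 1 _) empty

-- The minimal available value is unique and exists iff some value is available.
sum-over-minimal : ∀ P n (x : ℤ) → sumBelow n (λ i → when (isMinimal P i) x) ≡ when (anyUpTo P n) x
sum-over-minimal P zero    x = refl
sum-over-minimal P (suc n) x rewrite sum-over-minimal P n x with anyUpTo P n | P (suc n)
... | true  | true  = ℤP.+-identityʳ x
... | true  | false = ℤP.+-identityʳ x
... | false | true  = ℤP.+-identityˡ x
... | false | false = refl

isDescent-pos : ∀ a i → ∣ a ∣ ≤ i → isDescent a (+ suc i) ≡ 0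
isDescent-pos a i |a|≤i = cong (λ d → if d then 1 else 0) (dec-false (+ suc i <? a) (notBelow a |a|≤i))
  where
  notBelow : ∀ a → ∣ a ∣ ≤ i → ¬ (+ suc i ℤ.< a)
  notBelow (+ n)    n≤i (ℤ.+<+ i<n) = ℕP.<-irrefl refl (ℕP.<-≤-trans i<n (ℕP.m≤n⇒m≤1+n n≤i))
  notBelow -[1+ n ] _   ()

isDescent-neg : ∀ a i → ∣ a ∣ ≤ i → isDescent a -[1+ i ] ≡ 1
isDescent-neg (+ n)    i n≤i   rewrite dec-true (-[1+ i ] <? + n) ℤ.-<+ = refl
isDescent-neg -[1+ n ] i 1+n≤i rewrite dec-true (-[1+ i ] <? -[1+ n ]) (ℤ.-<- 1+n≤i) = refl

isDescent-far : ∀ a i → suc i < ∣ a ∣ → isDescent a (+ suc i) ≡ isDescent a -[1+ i ]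
isDescent-far (+ n) i i<n
  rewrite dec-true (+ suc i <? + n) (ℤ.+<+ i<n) | dec-true (-[1+ i ] <? + n) ℤ.-<+ = refl
isDescent-far -[1+ n ] i i<n
  rewrite dec-false (+ suc i <? -[1+ n ]) (λ ())
        | dec-false (-[1+ i ] <? -[1+ n ]) (λ { (ℤ.-<- n<i) → ℕP.<-asym n<i (ℕP.≤-pred i<n) }) = refl

-- If |a| < i+1, then +(i+1) is an ascent and -(i+1) a descent after a, and
-- the two shifted counts combine by Pascal's rule.
shifted-step : ∀ m a i b k → ∣ a ∣ ≤ i →
  shifted m (b +ℕ isDescent a (+ suc i)) k - shifted m (b +ℕ isDescent a -[1+ i ]) k ≡ shifted (suc m) b k
shifted-step m a i b k |a|≤i
  rewrite isDescent-pos a i |a|≤i | isDescent-neg a i |a|≤i | ℕP.+-identityʳ b | ℕP.+-comm b 1 =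
  shifted-pascal m b k

shifted-cancel : ∀ m a i b k → suc i < ∣ a ∣ →
  shifted m (b +ℕ isDescent a (+ suc i)) k - shifted m (b +ℕ isDescent a -[1+ i ]) k ≡ 0ℤ
shifted-cancel m a i b k 1+i<|a| rewrite isDescent-far a i 1+i<|a| = ℤP.+-inverseʳ (shifted m (b +ℕ isDescent a -[1+ i ]) k)

module SignedCount (n : ℕ) where

  signedSum : ℤ → (ℕ → Bool) → ℕ → ℕ → ℕ → ℤ
  signedSum a P m b k = sumBy (weight a P b k) (words n m)

  letterPair : ℤ → (ℕ → Bool) → ℕ → ℕ → ℕ → ℕ → ℤ
  letterPair a P m b k i = when (P (suc i))
    (signedSum (+ suc i) (remove P (suc i)) m (b +ℕ isDescent a (+ suc i)) k
      - signedSum -[1+ i ] (remove P (suc i)) m (b +ℕ isDescent a -[1+ i ]) k)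

  signedSum-suc : ∀ a P m b k → signedSum a P (suc m) b k ≡ sumBelow n (letterPair a P m b k)
  signedSum-suc a P m b k = begin
    sumBy (weight a P b k) (concatMap (λ w → map (_∷ w) (signedVals n)) (words n m))
      ≡⟨ sumBy-concatMap _ _ (words n m) ⟩
    sumBy (λ w → sumBy (weight a P b k) (map (_∷ w) (signedVals n))) (words n m)
      ≡⟨ sumBy-cong (words n m) (λ w → sumBy-map (weight a P b k) (_∷ w) (signedVals n)) ⟩
    sumBy (λ w → sumBy (λ x → weight a P b k (x ∷ w)) (signedVals n)) (words n m)
      ≡⟨ sumBy-swap (λ x w → weight a P b k (x ∷ w)) (signedVals n) (words n m) ⟩
    sumBy (λ x → sumBy (λ w → weight a P b k (x ∷ w)) (words n m)) (signedVals n)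
      ≡⟨ sumBy-cong (signedVals n) byFirstLetter ⟩
    sumBy first (signedVals n)
      ≡⟨ sumBy-++ first (map (λ i → + suc i) (upTo n)) (map (λ i → -[1+ i ]) (upTo n)) ⟩
    sumBy first (map (λ i → + suc i) (upTo n)) + sumBy first (map (λ i → -[1+ i ]) (upTo n))
      ≡⟨ cong₂ _+_ (sumBy-map first (λ i → + suc i) (upTo n)) (sumBy-map first (λ i → -[1+ i ]) (upTo n)) ⟩
    sumBy (λ i → first (+ suc i)) (upTo n) + sumBy (λ i → first -[1+ i ]) (upTo n)
      ≡⟨ sym (sumBy-+ (λ i → first (+ suc i)) (λ i → first -[1+ i ]) (upTo n)) ⟩
    sumBy (λ i → first (+ suc i) + first -[1+ i ]) (upTo n)
      ≡⟨ sumBy-cong (upTo n) (λ i → when-+ (P (suc i)) _ _) ⟩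
    sumBy (letterPair a P m b k) (upTo n)
      ≡⟨ sumBy-upTo (letterPair a P m b k) n ⟩
    sumBelow n (letterPair a P m b k) ∎
    where
    open ≡-Reasoning
    first : ℤ → ℤ
    first x = when (P ∣ x ∣) (negateWhen (does (x <? 0ℤ)) (signedSum x (remove P ∣ x ∣) m (b +ℕ isDescent a x) k))
    byFirstLetter : ∀ x → sumBy (λ w → weight a P b k (x ∷ w)) (words n m) ≡ first x
    byFirstLetter x = begin
      sumBy (λ w → weight a P b k (x ∷ w)) (words n m)
        ≡⟨ sumBy-cong (words n m) (weight-∷ a P b k x) ⟩
      sumBy (λ w → when (P ∣ x ∣) (negateWhen (does (x <? 0ℤ)) (weight x (remove P ∣ x ∣) (b +ℕ isDescent a x) k w))) (words n m)
        ≡⟨ sumBy-when (P ∣ x ∣) _ (words n m) ⟩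
      when (P ∣ x ∣) (sumBy (λ w → negateWhen (does (x <? 0ℤ)) (weight x (remove P ∣ x ∣) (b +ℕ isDescent a x) k w)) (words n m))
        ≡⟨ cong (when (P ∣ x ∣)) (sumBy-negateWhen (does (x <? 0ℤ)) _ (words n m)) ⟩
      first x ∎

  BelowAvailable : ℤ → (ℕ → Bool) → Set
  BelowAvailable a P = ∀ j → j < n → P (suc j) ≡ true → ∣ a ∣ ≤ j

  AboveSomeAvailable : ℤ → (ℕ → Bool) → Set
  AboveSomeAvailable a P = ∃₂ λ j (_ : j < n) → P (suc j) ≡ true × suc j < ∣ a ∣

  ShiftedClaim : ℕ → Set
  ShiftedClaim m = ∀ a P b k → count P n ≡ m → BelowAvailable a P → signedSum a P m b k ≡ shifted m b k

  VanishingClaim : ℕ → Set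
  VanishingClaim m = ∀ a P b k → count P n ≡ m → AboveSomeAvailable a P → signedSum a P m b k ≡ 0ℤ

  letterPair-value : ∀ {m} → ShiftedClaim m → VanishingClaim m →
    ∀ a P b k i → count P n ≡ suc m → i < n →
    letterPair a P m b k i ≡
      when (isMinimal P i) (shifted m (b +ℕ isDescent a (+ suc i)) k - shifted m (b +ℕ isDescent a -[1+ i ]) k)
  letterPair-value {m} shiftedClaim vanishingClaim a P b k i sized i<n with P (suc i) in available
  ... | false = refl
  ... | true with anyUpTo P i in smaller
  ...   | true  = cong₂ _-_ (vanishes (+ suc i) (b +ℕ isDescent a (+ suc i)) refl)
                              (vanishes -[1+ i ] (b +ℕ isDescent a -[1+ i ]) refl)
    where
    vanishes : ∀ x b′ → ∣ x ∣ ≡ suc i → signedSum x (remove P (suc i)) m b′ k ≡ 0ℤ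
    vanishes x b′ |x|≡1+i with anyUpTo-true P i smaller
    ... | j , j<i , availableJ =
      vanishingClaim x (remove P (suc i)) b′ k (count-remove-suc P i n m i<n available sized)
        ( j , ℕP.<-trans j<i i<n
        , trans (remove-other P (suc i) (suc j) (λ e → ℕP.<⇒≢ j<i (sym (ℕP.suc-injective e)))) availableJ
        , subst (suc j <_) (sym |x|≡1+i) (s≤s j<i))
  ...   | false = cong₂ _-_ (isShifted (+ suc i) (b +ℕ isDescent a (+ suc i)) refl)
                              (isShifted -[1+ i ] (b +ℕ isDescent a -[1+ i ]) refl)
    where
    isShifted : ∀ x b′ → ∣ x ∣ ≡ suc i → signedSum x (remove P (suc i)) m b′ k ≡ shifted m b′ k
    isShifted x b′ |x|≡1+i = shiftedClaim x (remove P (suc i)) b′ k (count-remove-suc P i n m i<n available sized) below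
      where
      below : BelowAvailable x (remove P (suc i))
      below j j<n removed with remove-true P (suc i) (suc j) removed
      ... | availableJ , i≢j =
        subst (_≤ j) (sym |x|≡1+i) (ℕP.≤∧≢⇒< (anyUpTo-false-≤ P i j smaller availableJ) (λ e → i≢j (cong suc e)))

  claims : ∀ m → ShiftedClaim m × VanishingClaim m
  claims zero = emptyShifted , emptyVanishing
    where
    emptyShifted : ShiftedClaim zero
    emptyShifted a P b k _ _ rewrite ℕP.+-identityʳ b = trans (ℤP.+-identityʳ _) (shifted-zero b k)
    emptyVanishing : VanishingClaim zero
    emptyVanishing a P b k empty (j , j<n , availableJ , _)
      with () ← trans (sym (count-zero P n empty j j<n)) availableJ
  claims (suc m) = stepShifted , stepVanishing
    where
    shiftedClaim : ShiftedClaim m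
    shiftedClaim = proj₁ (claims m)
    vanishingClaim : VanishingClaim m
    vanishingClaim = proj₂ (claims m)

    stepShifted : ShiftedClaim (suc m)
    stepShifted a P b k sized below = begin
      signedSum a P (suc m) b k
        ≡⟨ signedSum-suc a P m b k ⟩
      sumBelow n (letterPair a P m b k)
        ≡⟨ sumBelow-cong n (λ i i<n → trans (letterPair-value shiftedClaim vanishingClaim a P b k i sized i<n)
                                             (when-cong (isMinimal P i) (pascalStep i i<n))) ⟩
      sumBelow n (λ i → when (isMinimal P i) (shifted (suc m) b k))
        ≡⟨ sum-over-minimal P n _ ⟩
      when (anyUpTo P n) (shifted (suc m) b k)
        ≡⟨ cong (λ p → when p (shifted (suc m) b k)) (count-suc⇒anyUpTo P n m sized) ⟩
      shifted (suc m) b k ∎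
      where
      open ≡-Reasoning
      -- after a, the letter +(i+1) is an ascent and -(i+1) a descent
      pascalStep : ∀ i → i < n → isMinimal P i ≡ true →
        shifted m (b +ℕ isDescent a (+ suc i)) k - shifted m (b +ℕ isDescent a -[1+ i ]) k ≡ shifted (suc m) b k
      pascalStep i i<n minimal = shifted-step m a i b k (below i i<n (proj₁ (isMinimal-spec P i minimal)))

    stepVanishing : VanishingClaim (suc m)
    stepVanishing a P b k sized (j , j<n , availableJ , 1+j<|a|) = begin
      signedSum a P (suc m) b k
        ≡⟨ signedSum-suc a P m b k ⟩
      sumBelow n (letterPair a P m b k)
        ≡⟨ sumBelow-cong n (λ i i<n → trans (letterPair-value shiftedClaim vanishingClaim a P b k i sized i<n)
                                             (when-cong (isMinimal P i) (cancel i))) ⟩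
      sumBelow n (λ i → when (isMinimal P i) 0ℤ)
        ≡⟨ sum-over-minimal P n 0ℤ ⟩
      when (anyUpTo P n) 0ℤ
        ≡⟨ when-zero (anyUpTo P n) ⟩
      0ℤ ∎
      where
      open ≡-Reasoning
      -- the least available value i+1 is at most j+1 < |a|
      cancel : ∀ i → isMinimal P i ≡ true →
        shifted m (b +ℕ isDescent a (+ suc i)) k - shifted m (b +ℕ isDescent a -[1+ i ]) k ≡ 0ℤ
      cancel i minimal = shifted-cancel m a i b k
        (ℕP.≤-<-trans (s≤s (anyUpTo-false-≤ P i j (proj₂ (isMinimal-spec P i minimal)) availableJ)) 1+j<|a|)

allAvailable : (ℕ → Bool) → List ℕ → Bool
allAvailable P []       = true
allAvailable P (u ∷ us) = P u ∧ allAvailable P us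

allAvailable-remove : ∀ P v vs →
  allAvailable (remove P v) vs ≡ allAvailable P vs ∧ does (all? (λ u → ¬? (v ℕ.≟ u)) vs)
allAvailable-remove P v []       = refl
allAvailable-remove P v (u ∷ us) rewrite allAvailable-remove P v us =
  ∧-interchange (P u) (not (does (v ℕ.≟ u))) (allAvailable P us) (does (all? (λ u → ¬? (v ℕ.≟ u)) us))

admissible-spec : ∀ P vs → admissible P vs ≡ allAvailable P vs ∧ does (unique? vs)
admissible-spec P []       = refl
admissible-spec P (v ∷ vs) rewrite admissible-spec (remove P v) vs | allAvailable-remove P v vs =
  trans (cong (P v ∧_) (BoolP.∧-assoc (allAvailable P vs) _ _)) (sym (BoolP.∧-assoc (P v) _ _))

admissible-everything : ∀ vs → admissible (λ _ → true) vs ≡ does (unique? vs)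
admissible-everything vs = trans (admissible-spec (λ _ → true) vs) (cong (_∧ does (unique? vs)) (allTrue vs))
  where
  allTrue : ∀ vs → allAvailable (λ _ → true) vs ≡ true
  allTrue []       = refl
  allTrue (u ∷ us) = allTrue us

count-everything : ∀ n → count (λ _ → true) n ≡ n
count-everything zero    = refl
count-everything (suc n) rewrite count-everything n = ℕP.+-comm n 1

even?-suc : ∀ m → even? (suc m) ≡ not (even? m)
even?-suc zero          = refl
even?-suc (suc zero)    = refl
even?-suc (suc (suc m)) = even?-suc m

sign-parity : ∀ w → sign w ≡ (if even? (negs w) then 1ℤ else -1ℤ)
sign-parity []      = refl
sign-parity (x ∷ w) with does (x <? 0ℤ)
... | false = sign-parity w
... | true rewrite even?-suc (negs w) | sign-parity w with even? (negs w)
...   | true  = refl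
...   | false = refl

split-by-bool : ∀ e z → z ≡ when (does (e Bool.≟ true)) z + when (does (e Bool.≟ false)) z
split-by-bool true  z = sym (ℤP.+-identityʳ z)
split-by-bool false z = sym (ℤP.+-identityˡ z)

signed-by-bool : ∀ e q s → s ≡ (if e then 1ℤ else -1ℤ) →
  when (does (e Bool.≟ true)) (when q 1ℤ) - when (does (e Bool.≟ false)) (when q 1ℤ) ≡ when q s
signed-by-bool true  true  s refl = refl
signed-by-bool true  false s refl = refl
signed-by-bool false true  s refl = refl
signed-by-bool false false s refl = refl

module ByParity (n k : ℕ) where

  hasDesc : List ℤ → Bool
  hasDesc w = does (desc w ℕ.≟ k)

  evenNegs? : (w : List ℤ) → Dec (even? (negs w) ≡ true)
  evenNegs? w = even? (negs w) Bool.≟ true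

  oddNegs? : (w : List ℤ) → Dec (even? (negs w) ≡ false)
  oddNegs? w = even? (negs w) Bool.≟ false

  withDesc-filter : {Q : List ℤ → Set} (Q? : ∀ w → Dec (Q w)) (L : List (List ℤ)) →
    + withDesc k (filter Q? L) ≡ sumBy (λ w → when (does (Q? w)) (when (hasDesc w) 1ℤ)) L
  withDesc-filter Q? L = trans (count-as-sum (λ w → desc w ℕ.≟ k) (filter Q? L)) (sumBy-filter Q? _ L)

  B-split : + B n k ≡ + D n k + + Dt n k
  B-split = begin
    + B n k
      ≡⟨ count-as-sum (λ w → desc w ℕ.≟ k) (Bn n) ⟩
    sumBy (λ w → when (hasDesc w) 1ℤ) (Bn n)
      ≡⟨ sumBy-cong (Bn n) (λ w → split-by-bool (even? (negs w)) _) ⟩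
    sumBy (λ w → evenPart w + oddPart w) (Bn n)
      ≡⟨ sumBy-+ evenPart oddPart (Bn n) ⟩
    sumBy evenPart (Bn n) + sumBy oddPart (Bn n)
      ≡⟨ sym (cong₂ _+_ (withDesc-filter evenNegs? (Bn n)) (withDesc-filter oddNegs? (Bn n))) ⟩
    + D n k + + Dt n k ∎
    where
    open ≡-Reasoning
    evenPart oddPart : List ℤ → ℤ
    evenPart w = when (does (evenNegs? w)) (when (hasDesc w) 1ℤ)
    oddPart  w = when (does (oddNegs? w)) (when (hasDesc w) 1ℤ)

  D-minus-Dt : + D n k - + Dt n k ≡ sumBy (λ w → when (hasDesc w) (sign w)) (Bn n)
  D-minus-Dt = begin
    + D n k - + Dt n k
      ≡⟨ cong₂ _-_ (withDesc-filter evenNegs? (Bn n)) (withDesc-filter oddNegs? (Bn n)) ⟩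
    sumBy evenPart (Bn n) - sumBy oddPart (Bn n)
      ≡⟨ cong (_+_ (sumBy evenPart (Bn n))) (sym (sumBy-neg oddPart (Bn n))) ⟩
    sumBy evenPart (Bn n) + sumBy (λ w → - oddPart w) (Bn n)
      ≡⟨ sym (sumBy-+ evenPart (λ w → - oddPart w) (Bn n)) ⟩
    sumBy (λ w → evenPart w - oddPart w) (Bn n)
      ≡⟨ sumBy-cong (Bn n) (λ w → signed-by-bool (even? (negs w)) (hasDesc w) (sign w) (sign-parity w)) ⟩
    sumBy (λ w → when (hasDesc w) (sign w)) (Bn n) ∎
    where
    open ≡-Reasoning
    evenPart oddPart : List ℤ → ℤ
    evenPart w = when (does (evenNegs? w)) (when (hasDesc w) 1ℤ)
    oddPart  w = when (does (oddNegs? w)) (when (hasDesc w) 1ℤ)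

  -- The signed count: Σ_{σ ∈ 𝓑ₙ, desc σ = k} sign σ = C(n,k)·(-1)^k, by claim (1)
  -- with a = 0, every value in {1,…,n} available and no descent recorded.
  signed-count : sumBy (λ w → when (hasDesc w) (sign w)) (Bn n) ≡ signedBinomial n k
  signed-count = begin
    sumBy (λ w → when (hasDesc w) (sign w)) (Bn n)
      ≡⟨ sumBy-filter (λ w → unique? (map ∣_∣ w)) _ (words n n) ⟩
    sumBy (λ w → when (does (unique? (map ∣_∣ w))) (when (hasDesc w) (sign w))) (words n n)
      ≡⟨ sumBy-cong (words n n) (λ w → cong (λ p → when p (when (hasDesc w) (sign w))) (sym (admissible-everything (map ∣_∣ w)))) ⟩
    SignedCount.signedSum n 0ℤ (λ _ → true) n 0 k
      ≡⟨ proj₁ (SignedCount.claims n n) 0ℤ (λ _ → true) 0 k (count-everything n) (λ _ _ _ → z≤n) ⟩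
    signedBinomial n k ∎
    where open ≡-Reasoning

double-from-sum-difference : ∀ x y s t → x + y ≡ s → x - y ≡ t → (+ 2 * x ≡ s + t) × (+ 2 * y ≡ s - t)
double-from-sum-difference x y _ _ refl refl = doubleFirst x y , doubleSecond x y
  where
  doubleFirst : ∀ x y → + 2 * x ≡ (x + y) + (x - y)
  doubleFirst = solve-∀
  doubleSecond : ∀ x y → + 2 * y ≡ (x + y) - (x - y)
  doubleSecond = solve-∀

-- Corollary 4.4.  The argument does not use k ≤ n (for k > n both sides are 0).
corollary4p4 : (n k : ℕ) → k ≤ n →
    ((+ 2) * (+ D n k) ≡ (+ B n k) + (+ (n C k)) * (-1ℤ ^ k))
      × ((+ 2) * (+ Dt n k) ≡ (+ B n k) - (+ (n C k)) * (-1ℤ ^ k))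
corollary4p4 n k _ =
  double-from-sum-difference (+ D n k) (+ Dt n k) (+ B n k) (signedBinomial n k)
    (sym B-split) (trans D-minus-Dt signed-count)
  where open ByParity n k
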